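{- Let $t$ be a positive integer and let $\lambda$ be a partition with Frobenius partition \[ \mathfrak{F}(\lambda)=\begin{pmatrix} a_1 & a_2 & \cdots & a_s\\ b_1 & b_2 & \cdots & b_s\end{pmatrix}. \] Then $\lambda$ is a $t$-core partition if and only if all of the following hold: (1) for all $i,j\in\{1,\dots,s\}$, $a_i+b_j+1\not\equiv 0 \pmod t$; (2) for each $i$, if $a_i\ge t$, then $a_i-t$ appears in the first row, i.e. $a_i-t\in\{a_1,\dots,a_s\}$; (3) for each $j$, if $b_j\ge t$, then $b_j-t$ appears in the second row, i.e. $b_j-t\in\{b_1,\dots,b_s\}$.
   Context: A partition $\lambda=(\lambda_1,\lambda_2,\dots)$ is a weakly decreasing sequence of positive integers; $\lambda'_j$ denotes the number of parts of $\lambda$ that are $\ge j$ (the length of column $j$ of the Young diagram). The hook length of box $(i,j)$ of the Young diagram is $h_{i,j}(\lambda)=(\lambda_i-i)+(\lambda'_j-j)+1$, and $\lambda$ is a $t$-core if no hook length is divisible by $t$. If $s$ is the largest integer with $\lambda_s-s\ge 0$ (the side of the Durfee square; $s=0$ for the empty partition), the Frobenius partition of $\lambda$ is the two-rowed array $\mathfrak{F}(\lambda)$ with $a_i=\lambda_i-i$ and $b_i=\lambda'_i-i$ for $i=1,\dots,s$; thus $a_1>\cdots>a_s\ge 0$ and $b_1>\cdots>b_s\ge 0$. -}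

module Defs where

open import Data.Nat using (ℕ; zero; suc; _+_; _∸_; _≤_; _<_; _≥_; _≤ᵇ_)
open import Data.Nat.Divisibility using (_∣_)
open import Data.List using (List; []; _∷_; length; filter; upTo; map)
open import Data.List.Relation.Unary.All using (All)
open import Data.List.Relation.Unary.Linked using (Linked)
open import Data.Product using (Σ; _×_; ∃-syntax)
open import Relation.Nullary using (¬_)
open import Data.Nat.Properties using (_≤?_)
open import Relation.Binary.PropositionalEquality using (_≡_)

IsPartition : List ℕ → Set
IsPartition l = All (λ x → 1 ≤ x) l × Linked (λ x y → y ≤ x) l

-- λ_i, 1-indexed; λ_i = 0 for i = 0 or i > length.
part : List ℕ → ℕ → ℕ
part []       _             = 0
part (x ∷ xs) zero          = 0
part (x ∷ xs) (suc zero)    = x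
part (x ∷ xs) (suc (suc i)) = part xs (suc i)

conj : List ℕ → ℕ → ℕ
conj l j = length (filter (λ x → j ≤? x) l)

IsBox : List ℕ → ℕ → ℕ → Set
IsBox l i j = 1 ≤ i × 1 ≤ j × j ≤ part l i

-- Hook length h_{i,j} = (λ_i - i) + (λ'_j - j) + 1, rearranged as
-- (λ_i - j) + (λ'_j - i) + 1, both summands nonnegative for boxes.
hook : List ℕ → ℕ → ℕ → ℕ
hook l i j = (part l i ∸ j) + (conj l j ∸ i) + 1

IsCore : ℕ → List ℕ → Set
IsCore t l = ∀ i j → IsBox l i j → ¬ (t ∣ hook l i j)

-- Durfee side s: the largest s with λ_s - s ≥ 0 (s = 0 if none).
-- Since λ is decreasing, { i ≥ 1 | λ_i ≥ i } = {1..s}; we define s as its size.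
durfee : List ℕ → ℕ
durfee l = length (filter (λ i → suc i ≤? part l (suc i)) (upTo (length l)))

frobA : List ℕ → ℕ → ℕ
frobA l i = part l i ∸ i

frobB : List ℕ → ℕ → ℕ
frobB l i = conj l i ∸ i

InRange : ℕ → ℕ → Set
InRange s i = 1 ≤ i × i ≤ s

Cond1 : ℕ → List ℕ → Set
Cond1 t l = ∀ i j → InRange (durfee l) i → InRange (durfee l) j →
  ¬ (t ∣ frobA l i + frobB l j + 1)

Cond2 : ℕ → List ℕ → Set
Cond2 t l = ∀ i → InRange (durfee l) i → t ≤ frobA l i →
  ∃[ k ] (InRange (durfee l) k × frobA l k + t ≡ frobA l i)

Cond3 : ℕ → List ℕ → Set
Cond3 t l = ∀ j → InRange (durfee l) j → t ≤ frobB l j →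
  ∃[ k ] (InRange (durfee l) k × frobB l k + t ≡ frobB l j)

{-# OPTIONS --safe #-}
-- Write f = part l and g = conj l, so that (k, j) is a box iff j ≤ f k iff k ≤ g j, the hook at
-- (i, j) is (f i − j) + (g j − i) + 1, and row k is on the diagonal iff k ≤ f k, with a_k = f k − k.
-- If i and j are both on the diagonal the hook is a_i + b_j + 1, which is condition (1). If column j
-- is off the diagonal (g j < j), the hook at (i, j) equals a_i − (j − g j − 1), and j − g j − 1 is no
-- Frobenius coordinate: a_k = j − g j − 1 would mean f k + g j + 1 = k + j, which conjugacy forbids.
-- So when the a_k are closed under subtracting t, a hook q t there would lead from a_i in q steps to
-- that impossible value; off-diagonal rows are symmetric. Conversely, if no hook equals t, then
-- f k − k decreases strictly below a diagonal row i, and if it skipped a_i − t, the column where it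
-- skips would carry a hook of length t in row i.
module Submission where

open import Defs
open import Data.Nat using (ℕ; _≤_)
open import Data.List using (List)
open import Data.Product using (_×_)
open import Function.Bundles using (_⇔_)

open import Data.Nat using (zero; suc; _+_; _*_; _∸_; _<_; z≤n; s≤s; s≤s⁻¹; _≤?_)
open import Data.Nat.Properties
open import Data.Nat.Divisibility using (_∣_; divides; ∣-refl)
open import Data.Nat.Tactic.RingSolver using (solve-∀)
open import Data.List using (_∷_; []; _++_; [_]; length; filter; upTo)
open import Data.List.Properties using (filter-all; filter-accept; filter-reject; filter-++; ++-identityʳ; length-upTo; upTo-∷ʳ)
open import Data.List.Relation.Unary.All.Properties using (applyUpTo⁺₁)
open import Data.List.Relation.Unary.Linked as Linked using (Linked; _∷_)
open import Data.Product using (_,_; proj₁; proj₂; ∃-syntax; map₁)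
open import Data.Sum using (inj₁; inj₂)
open import Data.Empty using (⊥-elim)
open import Function using (_∘_; const; id)
open import Function.Bundles using (mk⇔; Equivalence)
import Function.Properties.Equivalence as ⇔
open import Relation.Nullary using (¬_; yes; no)
open import Relation.Unary using (Pred) renaming (Decidable to Decidable₁)
open import Relation.Binary.PropositionalEquality using (_≡_; _≢_; refl; sym; trans; cong; cong₂; subst; module ≡-Reasoning)

private
  variable
    a b c d i j k s t x : ℕ
    xs : List ℕ
    f g : ℕ → ℕ

∸+∸-swap : j ≤ a → i ≤ b → i ≤ a → j ≤ b → (a ∸ j) + (b ∸ i) ≡ (a ∸ i) + (b ∸ j)
∸+∸-swap {j} {a} {i} {b} j≤a i≤b i≤a j≤b = +-cancelʳ-≡ (i + j) _ _ (begin
  (a ∸ j) + (b ∸ i) + (i + j)     ≡⟨ shuffle (a ∸ j) (b ∸ i) i j ⟩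
  ((a ∸ j) + j) + ((b ∸ i) + i)   ≡⟨ cong₂ _+_ (m∸n+n≡m j≤a) (m∸n+n≡m i≤b) ⟩
  a + b                           ≡⟨ cong₂ _+_ (m∸n+n≡m i≤a) (m∸n+n≡m j≤b) ⟨
  ((a ∸ i) + i) + ((b ∸ j) + j)   ≡⟨ shuffle (a ∸ i) (b ∸ j) j i ⟨
  (a ∸ i) + (b ∸ j) + (j + i)     ≡⟨ cong ((a ∸ i) + (b ∸ j) +_) (+-comm j i) ⟩
  (a ∸ i) + (b ∸ j) + (i + j)     ∎)
  where
  open ≡-Reasoning
  shuffle : ∀ m n u v → m + n + (u + v) ≡ (m + v) + (n + u)
  shuffle = solve-∀

jump-split : d < t → ∃[ e ] (i + (c + t) ≡ suc (i + d + c) + e × e + d + 1 ≡ t)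
jump-split {d} {t} {i} {c} d<t with m≤n⇒∃[o]m+o≡n d<t
... | e , refl = e , split i c d e , tally e d
  where
  split : ∀ i c d e → i + (c + (suc d + e)) ≡ suc (i + d + c) + e
  split = solve-∀
  tally : ∀ e d → e + d + 1 ≡ suc d + e
  tally = solve-∀

crossing : ∀ {p} {P : Pred ℕ p} → Decidable₁ P → ∀ {a} n → ¬ P a → P (a + n) →
           ∃[ d ] (d < n × ¬ P (a + d) × P (suc (a + d)))
crossing {P = P} P? {a} zero ¬Pa Pa+0 = ⊥-elim (¬Pa (subst P (+-identityʳ a) Pa+0))
crossing {P = P} P? {a} (suc n) ¬Pa P[a+1+n] with P? (a + n)
... | yes P[a+n] = let d , d<n , P-crosses = crossing P? n ¬Pa P[a+n] in d , m<n⇒m<1+n d<n , P-crosses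
... | no ¬P[a+n] = n , ≤-refl , ¬P[a+n] , subst P (+-suc a n) P[a+1+n]

module _ {p} {P : Pred ℕ p} (P? : Decidable₁ P) where

  private
    length-filter-upTo-all : (∀ {m} → m < a → P m) → length (filter P? (upTo a)) ≡ a
    length-filter-upTo-all {a} below = trans (cong length (filter-all P? (applyUpTo⁺₁ id a below))) (length-upTo a)

    length-filter-upTo-reject : ¬ P a → length (filter P? (upTo (suc a))) ≡ length (filter P? (upTo a))
    length-filter-upTo-reject {a} ¬Pa = begin
      length (filter P? (upTo (suc a)))               ≡⟨ cong (length ∘ filter P?) (upTo-∷ʳ a) ⟨
      length (filter P? (upTo a ++ [ a ]))            ≡⟨ cong length (filter-++ P? (upTo a) [ a ]) ⟩
      length (filter P? (upTo a) ++ filter P? [ a ])  ≡⟨ cong (λ ys → length (filter P? (upTo a) ++ ys)) (filter-reject P? ¬Pa) ⟩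
      length (filter P? (upTo a) ++ [])               ≡⟨ cong length (++-identityʳ (filter P? (upTo a))) ⟩
      length (filter P? (upTo a))                     ∎
      where open ≡-Reasoning

  <-length-filter-upTo : (∀ {a b} → a ≤ b → P b → P a) →
                         ∀ n {k} → k < length (filter P? (upTo n)) ⇔ (k < n × P k)
  <-length-filter-upTo downClosed zero = mk⇔ (λ ()) (λ { (() , _) })
  <-length-filter-upTo downClosed (suc n) with P? n
  ... | yes Pn rewrite length-filter-upTo-all (λ m<1+n → downClosed (s≤s⁻¹ m<1+n) Pn) =
    mk⇔ (λ k<1+n → k<1+n , downClosed (s≤s⁻¹ k<1+n) Pn) proj₁
  ... | no ¬Pn rewrite length-filter-upTo-reject ¬Pn =
    ⇔.trans (<-length-filter-upTo downClosed n)
            (mk⇔ (map₁ m<n⇒m<1+n) (λ (k<1+n , Pk) → ≤∧≢⇒< (s≤s⁻¹ k<1+n) (λ { refl → ¬Pn Pk }) , Pk))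

Conjugate : (ℕ → ℕ) → (ℕ → ℕ) → Set
Conjugate f g = ∀ {k j} → 1 ≤ k → 1 ≤ j → k ≤ g j ⇔ j ≤ f k

conjugate-sym : Conjugate f g → Conjugate g f
conjugate-sym f⊣g 1≤k 1≤j = ⇔.sym (f⊣g 1≤j 1≤k)

hookLength : (ℕ → ℕ) → (ℕ → ℕ) → ℕ → ℕ → ℕ
hookLength f g i j = (f i ∸ j) + (g j ∸ i) + 1

hookLength-transpose : ∀ f g i j → hookLength f g i j ≡ hookLength g f j i
hookLength-transpose f g i j = cong (_+ 1) (+-comm (f i ∸ j) (g j ∸ i))

Core : (ℕ → ℕ) → (ℕ → ℕ) → ℕ → Set
Core f g t = ∀ i j → 1 ≤ i × 1 ≤ j × j ≤ f i → ¬ t ∣ hookLength f g i j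

-- Row k lies on the diagonal with Frobenius coordinate c, phrased without truncated subtraction.
Frobenius : (ℕ → ℕ) → ℕ → ℕ → Set
Frobenius f k c = f k ≡ k + c

ShiftClosed : (ℕ → ℕ) → ℕ → Set
ShiftClosed f t = ∀ {i c} → 1 ≤ i → Frobenius f i (c + t) → ∃[ k ] (1 ≤ k × Frobenius f k c)

frobenius⇒≤ : Frobenius f k c → k ≤ f k
frobenius⇒≤ {k = k} {c} fk = subst (k ≤_) (sym fk) (m≤m+n k c)

frobenius⇒∸ : Frobenius f k c → f k ∸ k ≡ c
frobenius⇒∸ {k = k} {c} fk = trans (cong (_∸ k) fk) (m+n∸m≡n k c)

∸⇒frobenius : k ≤ f k → f k ∸ k ≡ c → Frobenius f k c
∸⇒frobenius {k} k≤fk refl = sym (m+[n∸m]≡n k≤fk)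

shiftClosed-multiple : ShiftClosed f t → ∀ q → 1 ≤ i → Frobenius f i (c + q * t) →
                       ∃[ k ] (1 ≤ k × Frobenius f k c)
shiftClosed-multiple {i = i} {c} closed zero 1≤i fi = i , 1≤i , trans fi (cong (i +_) (+-identityʳ c))
shiftClosed-multiple {t = t} {i} {c} closed (suc q) 1≤i fi =
  let k , 1≤k , fk = closed {c = c + q * t} 1≤i (trans fi (cong (i +_) (reassociate c t (q * t))))
  in shiftClosed-multiple closed q 1≤k fk
  where
  reassociate : ∀ c t u → c + (t + u) ≡ c + u + t
  reassociate = solve-∀

module Conjugates (f⊣g : Conjugate f g) where

  ≤g⇒≤f : 1 ≤ k → 1 ≤ j → k ≤ g j → j ≤ f k
  ≤g⇒≤f 1≤k 1≤j = Equivalence.to (f⊣g 1≤k 1≤j)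

  ≤f⇒≤g : 1 ≤ k → 1 ≤ j → j ≤ f k → k ≤ g j
  ≤f⇒≤g 1≤k 1≤j = Equivalence.from (f⊣g 1≤k 1≤j)

  antitone : 1 ≤ a → a ≤ b → f b ≤ f a
  antitone {a} {b} 1≤a a≤b with f b in fb
  ... | zero  = z≤n
  ... | suc m = ≤g⇒≤f 1≤a (s≤s z≤n) (≤-trans a≤b (≤f⇒≤g (≤-trans 1≤a a≤b) (s≤s z≤n) (≤-reflexive (sym fb))))

  diagonal-box : 1 ≤ i → 1 ≤ j → i ≤ f i → j ≤ g j → j ≤ f i
  diagonal-box {i} {j} 1≤i 1≤j i≤fi j≤gj with ≤-total i j
  ... | inj₁ i≤j = ≤-trans (≤g⇒≤f 1≤j 1≤j j≤gj) (antitone 1≤i i≤j)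
  ... | inj₂ j≤i = ≤-trans j≤i i≤fi

  hookLength-diagonal : 1 ≤ i → 1 ≤ j → i ≤ f i → j ≤ g j →
                        hookLength f g i j ≡ (f i ∸ i) + (g j ∸ j) + 1
  hookLength-diagonal 1≤i 1≤j i≤fi j≤gj =
    cong (_+ 1) (∸+∸-swap j≤fi (≤f⇒≤g 1≤i 1≤j j≤fi) i≤fi j≤gj)
    where j≤fi = diagonal-box 1≤i 1≤j i≤fi j≤gj

  core-transpose : Core f g t → Core g f t
  core-transpose {t} core i j (1≤i , 1≤j , j≤gi) =
    subst (λ h → ¬ t ∣ h) (hookLength-transpose f g j i) (core j i (1≤j , 1≤i , ≤g⇒≤f 1≤j 1≤i j≤gi))

  f[k]+g[j]+1≢k+j : 1 ≤ k → 1 ≤ j → f k + g j + 1 ≢ k + j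
  f[k]+g[j]+1≢k+j {k} {j} 1≤k 1≤j with k ≤? g j
  ... | yes k≤gj = <⇒≢ (≤-<-trans k+j≤ (m<m+n (f k + g j) (s≤s z≤n))) ∘ sym
    where
    k+j≤ : k + j ≤ f k + g j
    k+j≤ = subst (k + j ≤_) (+-comm (g j) (f k)) (+-mono-≤ k≤gj (≤g⇒≤f 1≤k 1≤j k≤gj))
  ... | no k≰gj = <⇒≢ (subst (f k + g j + 1 <_) (+-comm j k)
                      (≤-trans (≤-reflexive (two-more (f k) (g j))) (+-mono-≤ fk<j (≰⇒> k≰gj))))
    where
    fk<j : f k < j
    fk<j = ≰⇒> (k≰gj ∘ ≤f⇒≤g 1≤k 1≤j)
    two-more : ∀ m n → suc (m + n + 1) ≡ suc m + suc n
    two-more = solve-∀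

  jump-hook : 1 ≤ i → Frobenius f i (c + t) → d < t →
              i + d + c < f (i + d) → f (suc (i + d)) < suc (i + d + c) →
              suc (i + d + c) ≤ f i × hookLength f g i (suc (i + d + c)) ≡ t
  jump-hook {i} {c} {t} {d} 1≤i fi d<t below above =
    let e , fi≡J+e , e+d+1≡t = jump-split {i = i} {c} d<t in
    subst (J ≤_) (sym fi) (subst (J ≤_) (sym fi≡J+e) (m≤m+n J e)) ,
    (begin
      (f i ∸ J) + (g J ∸ i) + 1             ≡⟨ cong₂ (λ m n → (m ∸ J) + (n ∸ i) + 1) (trans fi fi≡J+e) gJ≡i+d ⟩
      (J + e ∸ J) + (i + d ∸ i) + 1         ≡⟨ cong₂ (λ m n → m + n + 1) (m+n∸m≡n J e) (m+n∸m≡n i d) ⟩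
      e + d + 1                             ≡⟨ e+d+1≡t ⟩
      t                                     ∎)
    where
    open ≡-Reasoning
    J : ℕ
    J = suc (i + d + c)
    gJ≡i+d : g J ≡ i + d
    gJ≡i+d = ≤-antisym (≮⇒≥ (λ i+d<gJ → <⇒≱ above (≤g⇒≤f (s≤s z≤n) (s≤s z≤n) i+d<gJ)))
                       (≤f⇒≤g (≤-trans 1≤i (m≤m+n i d)) (s≤s z≤n) below)

  -- Below row i, f k ∸ k decreases strictly from c + t; within t rows it either hits c or jumps
  -- over it, and a jump yields a hook of length t in row i (`jump-hook`).
  core⇒shiftClosed : 1 ≤ t → Core f g t → ShiftClosed f t
  core⇒shiftClosed {t} 1≤t core {i} {c} 1≤i fi = land (crossing (λ k → f k ≤? k + c) t start end)
    where
    start : ¬ f i ≤ i + c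
    start = <⇒≱ (subst (i + c <_) (sym fi) (+-monoʳ-< i (m<m+n c 1≤t)))
    end : f (i + t) ≤ i + t + c
    end = ≤-trans (antitone 1≤i (m≤m+n i t)) (≤-reflexive (trans fi (+-comm-middle i c t)))
      where
      +-comm-middle : ∀ i c t → i + (c + t) ≡ i + t + c
      +-comm-middle = solve-∀
    land : ∃[ d ] (d < t × ¬ f (i + d) ≤ i + d + c × f (suc (i + d)) ≤ suc (i + d + c)) →
           ∃[ k ] (1 ≤ k × Frobenius f k c)
    land (d , d<t , f[i+d]≰ , f[1+i+d]≤) with m≤n⇒m<n∨m≡n f[1+i+d]≤
    ... | inj₂ hit  = suc (i + d) , s≤s z≤n , hit
    ... | inj₁ jump =
      let J≤fi , hook≡t = jump-hook 1≤i fi d<t (≰⇒> f[i+d]≰) jump in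
      ⊥-elim (core i _ (1≤i , s≤s z≤n , J≤fi) (subst (t ∣_) (sym hook≡t) ∣-refl))

  offDiagonal-frobenius : 1 ≤ i → 1 ≤ j → j ≤ f i → g j < j →
                          Frobenius f i ((j ∸ suc (g j)) + hookLength f g i j)
  offDiagonal-frobenius {i} {j} 1≤i 1≤j j≤fi gj<j = sym (begin
    i + (v + (w + u + 1))     ≡⟨ rearrange i v w u ⟩
    w + (v + suc (u + i))     ≡⟨ cong (λ m → w + (v + suc m)) (m∸n+n≡m (≤f⇒≤g 1≤i 1≤j j≤fi)) ⟩
    w + (v + suc (g j))       ≡⟨ cong (w +_) (m∸n+n≡m gj<j) ⟩
    w + j                     ≡⟨ m∸n+n≡m j≤fi ⟩
    f i                       ∎)
    where
    open ≡-Reasoning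
    u v w : ℕ
    u = g j ∸ i
    v = j ∸ suc (g j)
    w = f i ∸ j
    rearrange : ∀ i v w u → i + (v + (w + u + 1)) ≡ w + (v + suc (u + i))
    rearrange = solve-∀

  offDiagonal-not-frobenius : 1 ≤ k → 1 ≤ j → g j < j → ¬ Frobenius f k (j ∸ suc (g j))
  offDiagonal-not-frobenius {k} {j} 1≤k 1≤j gj<j fk = f[k]+g[j]+1≢k+j 1≤k 1≤j (begin
    f k + g j + 1                       ≡⟨ cong (λ m → m + g j + 1) fk ⟩
    k + (j ∸ suc (g j)) + g j + 1       ≡⟨ rearrange k (j ∸ suc (g j)) (g j) ⟩
    k + ((j ∸ suc (g j)) + suc (g j))   ≡⟨ cong (k +_) (m∸n+n≡m gj<j) ⟩
    k + j                               ∎)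
    where
    open ≡-Reasoning
    rearrange : ∀ k v n → k + v + n + 1 ≡ k + (v + suc n)
    rearrange = solve-∀

  shiftClosed⇒offDiagonal-∤ : ShiftClosed f t → 1 ≤ i → 1 ≤ j → j ≤ f i → g j < j →
                              ¬ t ∣ hookLength f g i j
  shiftClosed⇒offDiagonal-∤ {i = i} {j} closed 1≤i 1≤j j≤fi gj<j (divides q hook≡qt) =
    let k , 1≤k , fk = shiftClosed-multiple closed q 1≤i
                         (subst (λ h → Frobenius f i ((j ∸ suc (g j)) + h)) hook≡qt
                                (offDiagonal-frobenius 1≤i 1≤j j≤fi gj<j))
    in offDiagonal-not-frobenius 1≤k 1≤j gj<j fk

IsDurfeeSide : (ℕ → ℕ) → ℕ → Set
IsDurfeeSide f s = ∀ {k} → 1 ≤ k → k ≤ s ⇔ k ≤ f k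

isDurfeeSide-conjugate : Conjugate f g → IsDurfeeSide f s → IsDurfeeSide g s
isDurfeeSide-conjugate f⊣g side 1≤k = ⇔.trans (side 1≤k) (⇔.sym (f⊣g 1≤k 1≤k))

-- Cond2 t l and Cond3 t l are ShiftCondition (durfee l) (part l) t and ShiftCondition (durfee l) (conj l) t.
ShiftCondition : ℕ → (ℕ → ℕ) → ℕ → Set
ShiftCondition s f t = ∀ i → InRange s i → t ≤ f i ∸ i →
  ∃[ k ] (InRange s k × f k ∸ k + t ≡ f i ∸ i)

module DurfeeSquare (side : IsDurfeeSide f s) where

  inRange⇒≤ : InRange s k → k ≤ f k
  inRange⇒≤ (1≤k , k≤s) = Equivalence.to (side 1≤k) k≤s

  ≤⇒inRange : 1 ≤ k → k ≤ f k → InRange s k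
  ≤⇒inRange 1≤k k≤fk = 1≤k , Equivalence.from (side 1≤k) k≤fk

  shiftCondition⇒shiftClosed : ShiftCondition s f t → ShiftClosed f t
  shiftCondition⇒shiftClosed {t} shift {i} {c} 1≤i fi =
    let k , k∈s , ak+t≡ai = shift i (≤⇒inRange 1≤i (frobenius⇒≤ {f = f} fi)) (subst (t ≤_) (sym ai≡c+t) (m≤n+m t c))
    in k , proj₁ k∈s , ∸⇒frobenius {f = f} (inRange⇒≤ k∈s) (+-cancelʳ-≡ t _ _ (trans ak+t≡ai ai≡c+t))
    where
    ai≡c+t : f i ∸ i ≡ c + t
    ai≡c+t = frobenius⇒∸ {f = f} fi

  shiftClosed⇒shiftCondition : ShiftClosed f t → ShiftCondition s f t
  shiftClosed⇒shiftCondition {t} closed i i∈s t≤ai =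
    let k , 1≤k , fk = closed (proj₁ i∈s) (∸⇒frobenius {f = f} (inRange⇒≤ i∈s) (sym (m∸n+n≡m t≤ai)))
    in k , ≤⇒inRange 1≤k (frobenius⇒≤ {f = f} fk) , trans (cong (_+ t) (frobenius⇒∸ {f = f} fk)) (m∸n+n≡m t≤ai)

Decreasing : List ℕ → Set
Decreasing = Linked (λ x y → y ≤ x)

part-≤-head : Decreasing (x ∷ xs) → ∀ k → part (x ∷ xs) k ≤ x
part-≤-head _ zero = z≤n
part-≤-head _ (suc zero) = ≤-refl
part-≤-head {xs = []} _ (suc (suc k)) = z≤n
part-≤-head {xs = y ∷ ys} (y≤x ∷ decreasing) (suc (suc k)) = ≤-trans (part-≤-head decreasing (suc k)) y≤x

part-length : ∀ {l} → 1 ≤ part l k → k ≤ length l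
part-length {zero}          {x ∷ xs} _ = z≤n
part-length {suc zero}      {x ∷ xs} _ = s≤s z≤n
part-length {suc (suc k)}   {x ∷ xs} h = s≤s (part-length {suc k} {xs} h)

conj-∷-accept : j ≤ x → conj (x ∷ xs) j ≡ suc (conj xs j)
conj-∷-accept {j} j≤x = cong length (filter-accept (j ≤?_) j≤x)

conj-∷-reject : ¬ j ≤ x → conj (x ∷ xs) j ≡ conj xs j
conj-∷-reject {j} j≰x = cong length (filter-reject (j ≤?_) j≰x)

part⊣conj : ∀ {l} → Decreasing l → Conjugate (part l) (conj l)
part⊣conj {[]} _ {suc k} {suc j} _ _ = mk⇔ (λ ()) (λ ())
part⊣conj {x ∷ xs} decreasing {suc k} {j} _ 1≤j with j ≤? x
... | yes j≤x rewrite conj-∷-accept {xs = xs} j≤x = row k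
  where
  row : ∀ k → suc k ≤ suc (conj xs j) ⇔ j ≤ part (x ∷ xs) (suc k)
  row zero    = mk⇔ (const j≤x) (const (s≤s z≤n))
  row (suc k) = ⇔.trans (mk⇔ s≤s⁻¹ s≤s) (part⊣conj (Linked.tail decreasing) (s≤s z≤n) 1≤j)
... | no j≰x rewrite conj-∷-reject {xs = xs} j≰x = mk⇔ (⊥-elim ∘ j≰x ∘ via-conj) (⊥-elim ∘ j≰x ∘ via-part)
  where
  via-conj : suc k ≤ conj xs j → j ≤ x
  via-conj 1+k≤conj = ≤-trans (Equivalence.to (part⊣conj (Linked.tail decreasing) ≤-refl 1≤j)
                                              (≤-trans (s≤s z≤n) 1+k≤conj))
                              (part-≤-head decreasing 2)
  via-part : j ≤ part (x ∷ xs) (suc k) → j ≤ x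
  via-part j≤part = ≤-trans j≤part (part-≤-head decreasing (suc k))

durfee-isDurfeeSide : ∀ {l} → Decreasing l → IsDurfeeSide (part l) (durfee l)
durfee-isDurfeeSide {l} decreasing {suc k} _ =
  ⇔.trans (<-length-filter-upTo (λ i → suc i ≤? part l (suc i)) diagonal-downClosed (length l))
          (mk⇔ proj₂ (λ 1+k≤part → part-length {l = l} (≤-trans (s≤s z≤n) 1+k≤part) , 1+k≤part))
  where
  open Conjugates (part⊣conj decreasing)
  diagonal-downClosed : a ≤ b → suc b ≤ part l (suc b) → suc a ≤ part l (suc a)
  diagonal-downClosed a≤b 1+b≤part = ≤-trans (s≤s a≤b) (≤-trans 1+b≤part (antitone (s≤s z≤n) (s≤s a≤b)))

theorem1p2 : (t : ℕ) → 1 ≤ t → (l : List ℕ) → IsPartition l →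
    IsCore t l ⇔ (Cond1 t l × Cond2 t l × Cond3 t l)
theorem1p2 t 1≤t l (_ , decreasing) = mk⇔ to from
  where
  part⊣conjˡ : Conjugate (part l) (conj l)
  part⊣conjˡ = part⊣conj decreasing
  open Conjugates part⊣conjˡ
  module ᵀ = Conjugates (conjugate-sym part⊣conjˡ)
  module Rows = DurfeeSquare (durfee-isDurfeeSide decreasing)
  module Cols = DurfeeSquare (isDurfeeSide-conjugate part⊣conjˡ (durfee-isDurfeeSide decreasing))

  to : IsCore t l → Cond1 t l × Cond2 t l × Cond3 t l
  to core = diagonal
          , Rows.shiftClosed⇒shiftCondition (core⇒shiftClosed 1≤t core)
          , Cols.shiftClosed⇒shiftCondition (ᵀ.core⇒shiftClosed 1≤t (core-transpose core))
    where
    diagonal : Cond1 t l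
    diagonal i j i∈s@(1≤i , _) j∈s@(1≤j , _) =
      subst (λ h → ¬ t ∣ h) (hookLength-diagonal 1≤i 1≤j i≤fi j≤gj)
            (core i j (1≤i , 1≤j , diagonal-box 1≤i 1≤j i≤fi j≤gj))
      where
      i≤fi : i ≤ part l i
      i≤fi = Rows.inRange⇒≤ i∈s
      j≤gj : j ≤ conj l j
      j≤gj = Cols.inRange⇒≤ j∈s

  from : Cond1 t l × Cond2 t l × Cond3 t l → IsCore t l
  from (diagonal , rowShift , colShift) i j (1≤i , 1≤j , j≤fi) with j ≤? conj l j | i ≤? part l i
  ... | no j≰gj | _ = shiftClosed⇒offDiagonal-∤ (Rows.shiftCondition⇒shiftClosed rowShift) 1≤i 1≤j j≤fi (≰⇒> j≰gj)
  ... | yes _ | no i≰fi =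
    subst (λ h → ¬ t ∣ h) (sym (hookLength-transpose (part l) (conj l) i j))
      (ᵀ.shiftClosed⇒offDiagonal-∤ (Cols.shiftCondition⇒shiftClosed colShift) 1≤j 1≤i (≤f⇒≤g 1≤i 1≤j j≤fi) (≰⇒> i≰fi))
  ... | yes j≤gj | yes i≤fi =
    subst (λ h → ¬ t ∣ h) (sym (hookLength-diagonal 1≤i 1≤j i≤fi j≤gj))
      (diagonal i j (Rows.≤⇒inRange 1≤i i≤fi) (Cols.≤⇒inRange 1≤j j≤gj))
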